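{- Let $\varphi$ be an $\mathsf{MTL}$ formula built from a finite set of propositions $\Sigma$ and let $\zeta=ONF_\Sigma(\varphi)$. Then $\zeta=\forall\downarrow.\,\zeta$.
   Context: A finite timed word over a finite set $\Delta$ is $\rho=(\sigma,\tau)$ with $\sigma_i\in2^{\Delta}\setminus\{\emptyset\}$ and $\tau_1\le\dots\le\tau_n$ in $\mathbb{R}_{\ge0}$. $\mathsf{MTL}$ formulae use propositions, boolean connectives and $\mathsf{U}_I,\mathsf{S}_I$ ($I$ an interval with endpoints in $\mathbb{N}\cup\{\infty\}$) with the standard strict pointwise semantics; $\rho\models\varphi$ iff $\rho,1\models\varphi$. Abbreviations: $\Diamond_I\phi=true\,\mathsf{U}_I\phi$, $\Box_I\phi=\neg\Diamond_I\neg\phi$, $\Box=\Box_{[0,\infty)}$, $\bot=\neg true$. For disjoint finite $\Sigma,X$, a $(\Sigma,X)$-oversampled behaviour is a timed word $\rho'=(\sigma',\tau')$ over $\Sigma\cup X$ whose first and last letters intersect $\Sigma$. Its oversampled projection $\rho'\downarrow X$ is the timed word over $\Sigma$ obtained by deleting all positions $i$ with $\sigma'_i\cap\Sigma=\emptyset$ and intersecting each remaining letter with $\Sigma$ (keeping time stamps). For $\varphi$ built from $\Sigma$ and $\psi$, $\varphi=\forall\downarrow.\psi$ means: for every finite $X$ disjoint from $\Sigma$, (i) every $(\Sigma,X)$-oversampled behaviour $\rho'$ with $\rho'\models\psi$ satisfies $\rho'\downarrow X\models\varphi$, and (ii) for every timed word $\rho$ over $\Sigma$ with $\rho\models\varphi$,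 every $(\Sigma,X)$-oversampled behaviour $\rho'$ with $\rho'\downarrow X=\rho$ satisfies $\rho'\models\psi$. With $act=\bigvee\Sigma$, $ONF_\Sigma(\psi)$ is obtained by recursively replacing each $a\in\Sigma$ by $a\wedge act$, each $\phi_i\mathsf{U}_I\phi_j$ by $(act\rightarrow ONF_\Sigma(\phi_i))\mathsf{U}_I(ONF_\Sigma(\phi_j)\wedge act)$, each $\phi_i\mathsf{S}_I\phi_j$ by $(act\rightarrow ONF_\Sigma(\phi_i))\mathsf{S}_I(ONF_\Sigma(\phi_j)\wedge act)$, each $\Box_I\phi$ by $\Box_I(act\rightarrow ONF_\Sigma(\phi))$, each $\Diamond_I\phi$ by $\Diamond_I(\phi\wedge act)$, and conjoining the result with $act\wedge(\Box\bot\rightarrow act)$. Note that $ONF_\Sigma(\varphi)$ is again a formula built from $\Sigma$. -}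

module Defs where

open import Data.Nat using (ℕ)
open import Data.Bool using (Bool; true; false; _∨_; if_then_else_)
open import Data.Fin using (Fin; zero; suc; _<_)
open import Data.List using (List; []; _∷_; length; lookup; mapMaybe)
open import Data.List.Relation.Unary.All using (All)
open import Data.List.Relation.Unary.Linked using (Linked)
open import Data.Maybe using (Maybe; just; nothing)
open import Data.Product using (_×_; _,_; proj₁; proj₂; ∃)
open import Data.Sum using (_⊎_; inj₁; inj₂)
open import Data.Empty using (⊥)
open import Data.Unit using (⊤)
open import Relation.Binary.PropositionalEquality using (_≡_)
import Relation.Nullary as N

-- Intervals with endpoints in ℕ ∪ {∞}.
-- lower endpoint l (closed? flag), upper endpoint: just u (closed? flag)
-- or nothing (= ∞, necessarily open).

record Interval : Set where
  constructor interval
  field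
    lower       : ℕ
    lowerClosed : Bool
    upper       : Maybe ℕ
    upperClosed : Bool

I₀∞ : Interval
I₀∞ = interval 0 true nothing false

-- Time domain (FIDELITY: ℝ≥0 is not available; we quantify over an
-- arbitrary time domain; ℝ≥0 with the usual order and
-- "t' - t ∈ I" is one instance).

record TimeDomain : Set₁ where
  field
    Time : Set
    _≤ₜ_ : Time → Time → Set
    -- diffIn I t t'  means  t' - t ∈ I
    diffIn : Interval → Time → Time → Set

infixr 6 _∧_
data Formula (m : ℕ) : Set where
  prop  : Fin m → Formula m
  tt    : Formula m
  ¬_    : Formula m → Formula m
  _∧_   : Formula m → Formula m → Formula m
  _U⟨_⟩_ : Formula m → Interval → Formula m → Formula m
  _S⟨_⟩_ : Formula m → Interval → Formula m → Formula m

module _ {m : ℕ} where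
  ⊥F : Formula m
  ⊥F = ¬ tt

  _∨F_ : Formula m → Formula m → Formula m
  φ ∨F ψ = ¬ (¬ φ ∧ ¬ ψ)

  _⇒_ : Formula m → Formula m → Formula m
  φ ⇒ ψ = ¬ (φ ∧ ¬ ψ)

  ◇⟨_⟩_ : Interval → Formula m → Formula m
  ◇⟨ I ⟩ φ = tt U⟨ I ⟩ φ

  □⟨_⟩_ : Interval → Formula m → Formula m
  □⟨ I ⟩ φ = ¬ (◇⟨ I ⟩ (¬ φ))

  □_ : Formula m → Formula m
  □ φ = □⟨ I₀∞ ⟩ φ

⋁ : ∀ {m} n → (Fin n → Formula m) → Formula m
⋁ ℕ.zero f = ⊥F
⋁ (ℕ.suc n) f = f zero ∨F ⋁ n (λ i → f (suc i))

act : ∀ {m} → Formula m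
act {m} = ⋁ m prop

onf : ∀ {m} → Formula m → Formula m
onf (prop a) = prop a ∧ act
onf tt = tt
onf (¬ φ) = ¬ onf φ
onf (φ ∧ ψ) = onf φ ∧ onf ψ
onf (φ U⟨ I ⟩ ψ) = (act ⇒ onf φ) U⟨ I ⟩ (onf ψ ∧ act)
onf (φ S⟨ I ⟩ ψ) = (act ⇒ onf φ) S⟨ I ⟩ (onf ψ ∧ act)

ONF : ∀ {m} → Formula m → Formula m
ONF φ = onf φ ∧ (act ∧ ((□ ⊥F) ⇒ act))

module _ (TD : TimeDomain) where
  open TimeDomain TD

  -- a timed word over A: list of (letter ⊆ A, time stamp)
  TWord : Set → Set
  TWord A = List ((A → Bool) × Time)

  NonEmptyList : ∀ {B : Set} → List B → Set
  NonEmptyList [] = ⊥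
  NonEmptyList (_ ∷ _) = ⊤

  WellFormed : ∀ {A} → TWord A → Set
  WellFormed w = NonEmptyList w
               × All (λ p → ∃ λ a → proj₁ p a ≡ true) w
               × Linked (λ p q → proj₂ p ≤ₜ proj₂ q) w

  Sat : ∀ {m A} → (Fin m → A) → (w : TWord A) → Fin (length w) → Formula m → Set
  Sat e w i (prop a) = proj₁ (lookup w i) (e a) ≡ true
  Sat e w i tt = ⊤
  Sat e w i (¬ φ) = N.¬ Sat e w i φ
  Sat e w i (φ ∧ ψ) = Sat e w i φ × Sat e w i ψ
  Sat e w i (φ U⟨ I ⟩ ψ) = ∃ λ j → i < j
    × diffIn I (proj₂ (lookup w i)) (proj₂ (lookup w j))
    × Sat e w j ψ
    × (∀ k → i < k → k < j → Sat e w k φ)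
  Sat e w i (φ S⟨ I ⟩ ψ) = ∃ λ j → j < i
    × diffIn I (proj₂ (lookup w j)) (proj₂ (lookup w i))
    × Sat e w j ψ
    × (∀ k → j < k → k < i → Sat e w k φ)

  Models : ∀ {m A} → (Fin m → A) → TWord A → Formula m → Set
  Models e [] φ = ⊥
  Models e w@(_ ∷ _) φ = Sat e w zero φ

  anyFin : ∀ n → (Fin n → Bool) → Bool
  anyFin ℕ.zero f = false
  anyFin (ℕ.suc n) f = f zero ∨ anyFin n (λ i → f (suc i))

  meetsΣ : ∀ {m k} → (Fin m ⊎ Fin k → Bool) → Bool
  meetsΣ {m} s = anyFin m (λ a → s (inj₁ a))

  FirstMeetsΣ : ∀ {m k} → TWord (Fin m ⊎ Fin k) → Set
  FirstMeetsΣ [] = ⊥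
  FirstMeetsΣ (p ∷ _) = meetsΣ (proj₁ p) ≡ true

  LastMeetsΣ : ∀ {m k} → TWord (Fin m ⊎ Fin k) → Set
  LastMeetsΣ [] = ⊥
  LastMeetsΣ (p ∷ []) = meetsΣ (proj₁ p) ≡ true
  LastMeetsΣ (_ ∷ q ∷ w) = LastMeetsΣ (q ∷ w)

  Oversampled : ∀ m k → TWord (Fin m ⊎ Fin k) → Set
  Oversampled m k w = WellFormed w × FirstMeetsΣ w × LastMeetsΣ w

  proj↓ : ∀ {m k} → TWord (Fin m ⊎ Fin k) → TWord (Fin m)
  proj↓ = mapMaybe (λ p → if meetsΣ (proj₁ p)
                            then just ((λ a → proj₁ p (inj₁ a)) , proj₂ p)
                            else nothing)

  -- φ = ∀↓. ψ  (φ, ψ both built from Σ = Fin m); X ranges over Fin k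
  ForallDown : ∀ m → Formula m → Formula m → Set
  ForallDown m φ ψ = ∀ (k : ℕ) →
      (∀ (ρ' : TWord (Fin m ⊎ Fin k)) → Oversampled m k ρ'
         → Models inj₁ ρ' ψ → Models (λ a → a) (proj↓ ρ') φ)
    × (∀ (ρ : TWord (Fin m)) → WellFormed ρ → Models (λ a → a) ρ φ
         → ∀ (ρ' : TWord (Fin m ⊎ Fin k)) → Oversampled m k ρ'
         → proj↓ ρ' ≡ ρ → Models inj₁ ρ' ψ)

-- act holds at a position of an oversampled behaviour ρ′ exactly when its letter meets Σ, i.e.
-- exactly at the positions that survive in ρ′ ↓ X, and these sit inside ρ′ along an order
-- embedding that preserves letters (restricted to Σ) and time stamps. ONF relativises every
-- temporal operator to act: an until/since witness must satisfy act, and the obligation at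
-- intermediate positions is guarded by act, hence vacuous at the deleted positions. By induction
-- on φ, onf φ therefore has the same truth value at a position of ρ′ ↓ X and at its image in ρ′.
-- The remaining conjuncts of ONF φ are act and the consequence □⊥ ⇒ act of act. Since the first
-- letter of ρ′ meets Σ, the first positions of the two words correspond, which gives both
-- halves of ∀↓ at once.
module Submission where

open import Data.Nat using (ℕ; zero; suc; s≤s; z≤n)
open import Data.Bool using (Bool; true; false; if_then_else_)
open import Data.Bool.Properties using (_≟_; not-¬)
open import Data.Fin using (Fin; zero; suc; toℕ; _<_)
open import Data.List using (List; _∷_; length; lookup; mapMaybe)
open import Data.Maybe using (just; nothing)
open import Data.Product using (_×_; _,_; proj₁; proj₂; Σ-syntax)
open import Data.Product.Function.NonDependent.Propositional using (_×-⇔_)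
open import Data.Sum using (_⊎_; inj₁)
open import Data.Unit using (tt)
open import Function using (id)
open import Function.Bundles using (_⇔_; mk⇔; module Equivalence)
open import Function.Construct.Composition using (_⇔-∘_)
open import Function.Construct.Symmetry using (⇔-sym)
open import Function.Related.Propositional using (K-reflexive)
open import Function.Related.TypeIsomorphisms using (¬-cong-⇔)
open import Relation.Nullary.Decidable using (decidable-stable)
open import Relation.Nullary.Negation using (contradiction)
open import Relation.Binary.PropositionalEquality using (_≡_; refl; cong; sym; subst; subst₂)

open import Defs
open Equivalence using (to; from)

module Selection {A B : Set} (keep : A → Bool) (g : A → B) where

  select : List A → List B
  select = mapMaybe (λ x → if keep x then just (g x) else nothing)

  origin : (w : List A) → Fin (length (select w)) → Fin (length w)
  origin (x ∷ w) j with keep x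
  origin (x ∷ w) zero    | true  = zero
  origin (x ∷ w) (suc j) | true  = suc (origin w j)
  origin (x ∷ w) j       | false = suc (origin w j)

  lookup-select : ∀ w j → lookup (select w) j ≡ g (lookup w (origin w j))
  lookup-select (x ∷ w) j with keep x
  lookup-select (x ∷ w) zero    | true  = refl
  lookup-select (x ∷ w) (suc j) | true  = lookup-select w j
  lookup-select (x ∷ w) j       | false = lookup-select w j

  origin-surjective : ∀ w i → keep (lookup w i) ≡ true →
                      Σ[ j ∈ Fin (length (select w)) ] origin w j ≡ i
  origin-surjective (x ∷ w) zero    kept with keep x
  ... | true = zero , refl
  origin-surjective (x ∷ w) (suc i) kept with keep x | origin-surjective w i kept
  ... | true  | j , refl = suc j , refl
  ... | false | j , refl = j , refl

  origin-head : ∀ {x} w → keep x ≡ true →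
                Σ[ j ∈ Fin (length (select (x ∷ w))) ] toℕ j ≡ 0 × origin (x ∷ w) j ≡ zero
  origin-head w kept rewrite kept = zero , refl , refl

  origin-monotone : ∀ w {j j′} → j < j′ → origin w j < origin w j′
  origin-monotone (x ∷ w) {j} {j′} j<j′ with keep x
  origin-monotone (x ∷ w) {zero}  {suc j′} _         | true  = s≤s z≤n
  origin-monotone (x ∷ w) {suc j} {suc j′} (s≤s j<j′) | true  = s≤s (origin-monotone w j<j′)
  origin-monotone (x ∷ w)                 j<j′      | false = s≤s (origin-monotone w j<j′)

  origin-monotone⁻¹ : ∀ w {j j′} → origin w j < origin w j′ → j < j′
  origin-monotone⁻¹ (x ∷ w) {j} {j′} oj<oj′ with keep x
  origin-monotone⁻¹ (x ∷ w) {zero}  {suc j′} _           | true  = s≤s z≤n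
  origin-monotone⁻¹ (x ∷ w) {suc j} {suc j′} (s≤s oj<oj′) | true  = s≤s (origin-monotone⁻¹ w oj<oj′)
  origin-monotone⁻¹ (x ∷ w)                 (s≤s oj<oj′) | false = origin-monotone⁻¹ w oj<oj′

  ∀-between-origin : ∀ w (P : Fin (length w) → Set) → (∀ i → keep (lookup w i) ≡ false → P i) →
                     ∀ {j j′} → (∀ k → j < k → k < j′ → P (origin w k)) →
                     ∀ i → origin w j < i → i < origin w j′ → P i
  ∀-between-origin w P dropped between i oj<i i<oj′ with keep (lookup w i) in kept
  ... | false = dropped i kept
  ... | true with origin-surjective w i kept
  ...   | k , refl = between k (origin-monotone⁻¹ w oj<i) (origin-monotone⁻¹ w i<oj′)

module _ (TD : TimeDomain) {m : ℕ} where
  open TimeDomain TD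

  Sat-⋁-prop : ∀ {A} (e : Fin m → A) (v : TWord TD A) i n (f : Fin n → Fin m) →
               Sat TD e v i (⋁ n (λ x → prop (f x))) ⇔
               (anyFin TD n (λ x → proj₁ (lookup v i) (e (f x))) ≡ true)
  Sat-⋁-prop e v i zero    f = mk⇔ (λ ¬⊤ → contradiction tt ¬⊤) λ ()
  Sat-⋁-prop e v i (suc n) f with proj₁ (lookup v i) (e (f zero))
  ... | true  = mk⇔ (λ _ → refl) (λ _ (¬head , _) → ¬head refl)
  ... | false = mk⇔
      (λ ¬both → decidable-stable (_ ≟ true) (λ ¬rest → ¬both ((λ ()) , λ r → ¬rest (to tail r))))
      (λ rest (_ , ¬tail) → ¬tail (from tail rest))
    where tail = Sat-⋁-prop e v i n (λ x → f (suc x))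

  Sat-act : ∀ {A} (e : Fin m → A) (v : TWord TD A) i →
            Sat TD e v i act ⇔ (anyFin TD m (λ a → proj₁ (lookup v i) (e a)) ≡ true)
  Sat-act e v i = Sat-⋁-prop e v i m id

  Sat-ONF : ∀ {A} (e : Fin m → A) (v : TWord TD A) i φ →
            Sat TD e v i (ONF φ) ⇔ (Sat TD e v i (onf φ) × Sat TD e v i act)
  Sat-ONF e v i φ = mk⇔ (λ (s , a , _) → s , a) (λ (s , a) → s , a , λ (_ , ¬a) → ¬a a)

  Models⇔Sat-first : ∀ {A} (e : Fin m → A) (v : TWord TD A) (j : Fin (length v)) φ →
                     toℕ j ≡ 0 → Models TD e v φ ⇔ Sat TD e v j φ
  Models⇔Sat-first e (_ ∷ _) zero φ refl = mk⇔ id id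

  module Projection {k : ℕ} (w : TWord TD (Fin m ⊎ Fin k)) where
    open Selection {A = (Fin m ⊎ Fin k → Bool) × Time} {B = (Fin m → Bool) × Time}
                   (λ p → meetsΣ TD (proj₁ p)) (λ p → (λ a → proj₁ p (inj₁ a)) , proj₂ p) public

    meets : Fin (length w) → Bool
    meets i = meetsΣ TD (proj₁ (lookup w i))

    Agrees : Formula m → Set
    Agrees φ = ∀ j → Sat TD id (proj↓ TD w) j φ ⇔ Sat TD inj₁ w (origin w j) φ

    time-origin : ∀ j → proj₂ (lookup (proj↓ TD w) j) ≡ proj₂ (lookup w (origin w j))
    time-origin j = cong proj₂ (lookup-select w j)

    agrees-prop : ∀ a → Agrees (prop a)
    agrees-prop a j = K-reflexive (cong (λ p → proj₁ p a ≡ true) (lookup-select w j))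

    agrees-act : Agrees act
    agrees-act j = ⇔-sym (Sat-act inj₁ w (origin w j))
               ⇔-∘ (K-reflexive (cong (λ p → anyFin TD m (proj₁ p) ≡ true) (lookup-select w j))
               ⇔-∘ Sat-act id (proj↓ TD w) j)

    act-meets : ∀ i → Sat TD inj₁ w i act → meets i ≡ true
    act-meets i = to (Sat-act inj₁ w i)

    guarded-vacuous : ∀ φ i → meets i ≡ false → Sat TD inj₁ w i (act ⇒ φ)
    guarded-vacuous φ i dropped (a , _) = not-¬ dropped (act-meets i a)

    agrees-∧ : ∀ {φ ψ} → Agrees φ → Agrees ψ → Agrees (φ ∧ ψ)
    agrees-∧ agφ agψ j = agφ j ×-⇔ agψ j

    agrees-⇒ : ∀ {φ ψ} → Agrees φ → Agrees ψ → Agrees (φ ⇒ ψ)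
    agrees-⇒ agφ agψ j = ¬-cong-⇔ (agφ j ×-⇔ ¬-cong-⇔ (agψ j))

    agrees-U : ∀ {φ ψ} I → Agrees (act ⇒ φ) → Agrees (ψ ∧ act) → Agrees ((act ⇒ φ) U⟨ I ⟩ (ψ ∧ act))
    agrees-U {φ} {ψ} I hold goal j = mk⇔ lift lower
      where
      lift : Sat TD id (proj↓ TD w) j ((act ⇒ φ) U⟨ I ⟩ (ψ ∧ act)) →
             Sat TD inj₁ w (origin w j) ((act ⇒ φ) U⟨ I ⟩ (ψ ∧ act))
      lift (j′ , j<j′ , d , s , between) =
        origin w j′ , origin-monotone w j<j′ , subst₂ (diffIn I) (time-origin j) (time-origin j′) d ,
        to (goal j′) s ,
        ∀-between-origin w _ (guarded-vacuous φ) (λ l j<l l<j′ → to (hold l) (between l j<l l<j′))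
      lower : Sat TD inj₁ w (origin w j) ((act ⇒ φ) U⟨ I ⟩ (ψ ∧ act)) →
              Sat TD id (proj↓ TD w) j ((act ⇒ φ) U⟨ I ⟩ (ψ ∧ act))
      lower (i′ , lt , d , s , between) with origin-surjective w i′ (act-meets i′ (proj₂ s))
      ... | j′ , refl =
        j′ , origin-monotone⁻¹ w lt , subst₂ (diffIn I) (sym (time-origin j)) (sym (time-origin j′)) d ,
        from (goal j′) s ,
        λ l j<l l<j′ → from (hold l) (between (origin w l) (origin-monotone w j<l) (origin-monotone w l<j′))

    agrees-S : ∀ {φ ψ} I → Agrees (act ⇒ φ) → Agrees (ψ ∧ act) → Agrees ((act ⇒ φ) S⟨ I ⟩ (ψ ∧ act))
    agrees-S {φ} {ψ} I hold goal j = mk⇔ lift lower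
      where
      lift : Sat TD id (proj↓ TD w) j ((act ⇒ φ) S⟨ I ⟩ (ψ ∧ act)) →
             Sat TD inj₁ w (origin w j) ((act ⇒ φ) S⟨ I ⟩ (ψ ∧ act))
      lift (j′ , j′<j , d , s , between) =
        origin w j′ , origin-monotone w j′<j , subst₂ (diffIn I) (time-origin j′) (time-origin j) d ,
        to (goal j′) s ,
        ∀-between-origin w _ (guarded-vacuous φ) (λ l j′<l l<j → to (hold l) (between l j′<l l<j))
      lower : Sat TD inj₁ w (origin w j) ((act ⇒ φ) S⟨ I ⟩ (ψ ∧ act)) →
              Sat TD id (proj↓ TD w) j ((act ⇒ φ) S⟨ I ⟩ (ψ ∧ act))
      lower (i′ , lt , d , s , between) with origin-surjective w i′ (act-meets i′ (proj₂ s))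
      ... | j′ , refl =
        j′ , origin-monotone⁻¹ w lt , subst₂ (diffIn I) (sym (time-origin j′)) (sym (time-origin j)) d ,
        from (goal j′) s ,
        λ l j′<l l<j → from (hold l) (between (origin w l) (origin-monotone w j′<l) (origin-monotone w l<j))

    agrees-onf : ∀ φ → Agrees (onf φ)
    agrees-onf (prop a)      = agrees-∧ (agrees-prop a) agrees-act
    agrees-onf tt j          = mk⇔ id id
    agrees-onf (¬ φ) j       = ¬-cong-⇔ (agrees-onf φ j)
    agrees-onf (φ ∧ ψ)       = agrees-∧ (agrees-onf φ) (agrees-onf ψ)
    agrees-onf (φ U⟨ I ⟩ ψ) = agrees-U I (agrees-⇒ agrees-act (agrees-onf φ)) (agrees-∧ (agrees-onf ψ) agrees-act)
    agrees-onf (φ S⟨ I ⟩ ψ) = agrees-S I (agrees-⇒ agrees-act (agrees-onf φ)) (agrees-∧ (agrees-onf ψ) agrees-act)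

    agrees-ONF : ∀ φ → Agrees (ONF φ)
    agrees-ONF φ j = ⇔-sym (Sat-ONF inj₁ w (origin w j) φ)
                 ⇔-∘ (agrees-∧ (agrees-onf φ) agrees-act j ⇔-∘ Sat-ONF id (proj↓ TD w) j φ)

  Models-proj↓-ONF : ∀ {k} (w : TWord TD (Fin m ⊎ Fin k)) → FirstMeetsΣ TD w → ∀ φ →
                     Models TD id (proj↓ TD w) (ONF φ) ⇔ Models TD inj₁ w (ONF φ)
  Models-proj↓-ONF w@(_ ∷ w′) first φ with Projection.origin-head w w′ first
  ... | j , j≡0 , oj≡0 = K-reflexive (cong (λ i → Sat TD inj₁ w i (ONF φ)) oj≡0)
                       ⇔-∘ (agrees-ONF φ j ⇔-∘ Models⇔Sat-first id (proj↓ TD w) j (ONF φ) j≡0)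
    where open Projection w

lemma3 : (TD : TimeDomain) (m : ℕ) (φ : Formula m) →
    ForallDown TD m (ONF φ) (ONF φ)
lemma3 TD m φ k =
    (λ ρ′ (_ , first , _) ⊨ρ′ → from (Models-proj↓-ONF TD ρ′ first φ) ⊨ρ′)
  , (λ ρ _ ⊨ρ ρ′ (_ , first , _) ρ′↓≡ρ →
       to (Models-proj↓-ONF TD ρ′ first φ) (subst (λ v → Models TD id v (ONF φ)) (sym ρ′↓≡ρ) ⊨ρ))
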